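{- Let $G=(V,w,\mu,d)$ be a locally finite weighted graph with general path distance $d$, and let $(x_0\sim\dots\sim x_{n-1})$ be a cycle in $G$ with $n\in\{3,4\}$. Then $(x_0\sim\dots\sim x_{n-1})\in X_2$.
   Context: $V$ countable, $w$ symmetric nonnegative vanishing on the diagonal, $\mu>0$, $x\sim y$ iff $w(x,y)>0$, each vertex has finitely many neighbors. A general path distance is a symmetric $d$ with $d(x,y)=0$ iff $x=y$ and $d(x,y)=\inf\{\sum_kd(x_{k-1},x_k):x=x_0\sim\dots\sim x_m=y\}$. A cycle is a sequence $(x_0\sim\dots\sim x_{n-1})$ of distinct vertices, $n\ge3$, $x_{n-1}\sim x_0$, considered up to cyclic rotation and reversal. $X_2$ is the set of cycles admitting a labeling $(x_0\sim\dots\sim x_{n-1})$ such that either $n=3$, or $d(x_0,x_3)<d(x_0,x_1)+d(x_1,x_2)+d(x_2,x_3)$ and $x_3\sim x_4\sim\dots\sim x_{n-1}\sim x_0$ is a geodesic (the sum of $d$ along it equals $d(x_3,x_0)$). -}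

module Defs where

open import Level using (0ℓ)
open import Data.Nat using (ℕ; zero; suc) renaming (_+_ to _+ℕ_; _∸_ to _∸ℕ_; _≤_ to _≤ℕ_; _*_ to _*ℕ_)
open import Data.Nat.DivMod using (_mod_)
open import Data.Fin using (Fin; toℕ)
open import Data.List using (List; []; _∷_; map; upTo; _++_)
open import Data.List.Membership.Propositional using (_∈_)
open import Data.List.Relation.Unary.Linked using (Linked)
open import Data.Product using (Σ; ∃; ∃-syntax; _×_)
open import Data.Sum using (_⊎_)
open import Data.Bool using (Bool; true; false)
open import Data.Empty using (⊥)
open import Relation.Nullary using (¬_)
open import Relation.Binary.PropositionalEquality using (_≡_)
open import Relation.Binary.Structures using (IsTotalOrder)
open import Algebra.Structures using (IsCommutativeRing)
open import Function.Definitions using (Injective)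

-- An axiomatic model of the real numbers: a Dedekind-complete ordered field.
-- (All models are isomorphic to ℝ; the stdlib has no real numbers.)
record RealNumbers : Set₁ where
  infix  4 _≈_ _≤_ _<_
  infixl 6 _+_
  infixl 7 _*_
  field
    Carrier : Set
    _≈_     : Carrier → Carrier → Set
    _+_ _*_ : Carrier → Carrier → Carrier
    -_      : Carrier → Carrier
    0# 1#   : Carrier
    _≤_     : Carrier → Carrier → Set
    isCommutativeRing : IsCommutativeRing _≈_ _+_ _*_ -_ 0# 1#
    0≉1     : ¬ (0# ≈ 1#)
    inverse : ∀ x → ¬ (x ≈ 0#) → ∃[ y ] (x * y ≈ 1#)
    isTotalOrder : IsTotalOrder _≈_ _≤_
    +-mono-≤ : ∀ {x y} z → x ≤ y → x + z ≤ y + z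
    *-nonneg : ∀ {x y} → 0# ≤ x → 0# ≤ y → 0# ≤ x * y
    complete : (P : Carrier → Set) → ∃ P → (∃[ b ] (∀ x → P x → x ≤ b)) →
               ∃[ s ] ((∀ x → P x → x ≤ s) × (∀ b → (∀ x → P x → x ≤ b) → s ≤ b))

  _<_ : Carrier → Carrier → Set
  x < y = (x ≤ y) × ¬ (x ≈ y)

module _ (ℝ : RealNumbers) where
  open RealNumbers ℝ

  Countable : Set → Set
  Countable V = ∃[ f ] Injective {A = V} {B = ℕ} _≡_ _≡_ f

  IsWeightedGraph : {V : Set} → (V → V → Carrier) → (V → Carrier) → Set
  IsWeightedGraph {V} w μ =
    (∀ x y → w x y ≈ w y x) × (∀ x y → 0# ≤ w x y) × (∀ x → w x x ≈ 0#) × (∀ x → 0# < μ x)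

  Adj : {V : Set} → (V → V → Carrier) → V → V → Set
  Adj w x y = 0# < w x y

  LocallyFinite : {V : Set} → (V → V → Carrier) → Set
  LocallyFinite {V} w = ∀ x → ∃[ ns ] (∀ y → Adj w x y → y ∈ ns)

  lastOf : {V : Set} → V → List V → V
  lastOf x []       = x
  lastOf x (y ∷ ys) = lastOf y ys

  -- x = x₀ ∼ x₁ ∼ … ∼ xₘ = y, given as x and the list (x₁ … xₘ)
  IsWalk : {V : Set} → (V → V → Carrier) → V → List V → V → Set
  IsWalk w x ys y = Linked (Adj w) (x ∷ ys) × lastOf x ys ≡ y

  len : {V : Set} → (V → V → Carrier) → V → List V → Carrier
  len d x []       = 0#
  len d x (y ∷ ys) = d x y + len d y ys

  IsInfOfPaths : {V : Set} → (V → V → Carrier) → (V → V → Carrier) → V → V → Set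
  IsInfOfPaths {V} w d x y =
    (∀ ys → IsWalk w x ys y → d x y ≤ len d x ys) ×
    (∀ c → (∀ ys → IsWalk w x ys y → c ≤ len d x ys) → c ≤ d x y)

  IsGeneralPathDistance : {V : Set} → (V → V → Carrier) → (V → V → Carrier) → Set
  IsGeneralPathDistance {V} w d =
    (∀ x y → 0# ≤ d x y) ×
    (∀ x y → d x y ≈ d y x) ×
    (∀ x y → (d x y ≈ 0# → x ≡ y) × (x ≡ y → d x y ≈ 0#)) ×
    (∀ x y → IsInfOfPaths w d x y)

  IsCycle : {V : Set} → (V → V → Carrier) → (n : ℕ) → (Fin n → V) → Set
  IsCycle w zero    c = ⊥
  IsCycle w (suc m) c =
    (3 ≤ℕ suc m) × Injective _≡_ _≡_ c × (∀ i → Adj w (c i) (c ((suc (toℕ i)) mod (suc m))))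

  -- relabelings of a cycle of length suc m: rotation by k, optionally reversed.
  -- relabel true  k i = c (k + i mod n);  relabel false k i = c (k - i mod n)
  relabel : {V : Set} → (m : ℕ) → (Fin (suc m) → V) → Bool → ℕ → ℕ → V
  relabel m c true  k i = c ((k +ℕ i) mod (suc m))
  relabel m c false k i = c ((k +ℕ m *ℕ i) mod (suc m))

  X₂Labeling : {V : Set} → (V → V → Carrier) → ℕ → (ℕ → V) → Set
  X₂Labeling d n y =
    n ≡ 3 ⊎
    ((d (y 0) (y 3) < d (y 0) (y 1) + d (y 1) (y 2) + d (y 2) (y 3)) ×
     -- y₃ ∼ y₄ ∼ … ∼ y_{n-1} ∼ y₀ is a geodesic
     (len d (y 3) (map (λ j → y (4 +ℕ j)) (upTo (n ∸ℕ 4)) ++ (y 0 ∷ [])) ≈ d (y 3) (y 0)))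

  X₂ : {V : Set} → (V → V → Carrier) → (n : ℕ) → (Fin n → V) → Set
  X₂ d zero    c = ⊥
  X₂ d (suc m) c = ∃[ b ] ∃[ k ] X₂Labeling d (suc m) (relabel m c b k)

{-# OPTIONS --safe #-}
module Submission where

open import Defs
open import Level using (0ℓ)
open import Data.Nat using (ℕ)
open import Data.Fin using (Fin; #_)
open import Data.Sum using (_⊎_; inj₁; inj₂)
open import Data.Product using (_,_; proj₁)
open import Data.Bool using (true; false)
open import Function using (case_of_)
open import Function.Definitions using (Injective)
open import Relation.Binary.PropositionalEquality using (_≡_; _≢_; refl)
open import Algebra.Bundles using (CommutativeRing)
open import Algebra.Structures using (IsCommutativeRing)
open import Relation.Binary.Structures using (IsTotalOrder)
import Algebra.Properties.Group as GroupProperties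
import Relation.Binary.Construct.NonStrictToStrict as NonStrictToStrict

-- For a 4-cycle x₀ ∼ x₁ ∼ x₂ ∼ x₃, read it
-- forwards or backwards from x₀ so that d(x₀,x₃) ≤ d(x₀,x₁). The one-edge path
-- x₃ ∼ x₀ is trivially a geodesic, and
--   d(x₀,x₃) ≤ d(x₀,x₁) < d(x₀,x₁) + d(x₁,x₂) ≤ d(x₀,x₁) + d(x₁,x₂) + d(x₂,x₃),
-- the strict step because x₁ ≠ x₂ forces d(x₁,x₂) > 0. So only nonnegativity and
-- definiteness of d are used, not the graph structure or the path-infimum property.

module OrderedFieldProperties (ℝ : RealNumbers) where
  open RealNumbers ℝ
  open IsCommutativeRing isCommutativeRing using (+-comm; +-identityˡ)
  open IsTotalOrder isTotalOrder using (antisym; trans; ≤-respˡ-≈; ≤-respʳ-≈; module Eq)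

  commutativeRing : CommutativeRing 0ℓ 0ℓ
  commutativeRing = record { isCommutativeRing = isCommutativeRing }

  open GroupProperties (CommutativeRing.+-group commutativeRing) using (identityʳ-unique)

  x≤x+y : ∀ {x y} → 0# ≤ y → x ≤ x + y
  x≤x+y {x} {y} 0≤y = ≤-respˡ-≈ (+-identityˡ x) (≤-respʳ-≈ (+-comm y x) (+-mono-≤ x 0≤y))

  x<x+y : ∀ {x y} → 0# < y → x < x + y
  x<x+y {x} {y} (0≤y , 0≉y) =
    x≤x+y 0≤y , λ x≈x+y → 0≉y (Eq.sym (identityʳ-unique x y (Eq.sym x≈x+y)))

  ≤-<-trans : ∀ {x y z} → x ≤ y → y < z → x < z
  ≤-<-trans = NonStrictToStrict.≤-<-trans _≈_ _≤_ trans antisym ≤-respˡ-≈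

  <-≤-trans : ∀ {x y z} → x < y → y ≤ z → x < z
  <-≤-trans = NonStrictToStrict.<-≤-trans _≈_ _≤_ Eq.sym trans antisym ≤-respʳ-≈

module DefiniteDistance (ℝ : RealNumbers) {V : Set} (d : V → V → RealNumbers.Carrier ℝ)
  (nonneg : ∀ x y → RealNumbers._≤_ ℝ (RealNumbers.0# ℝ) (d x y))
  (definite : ∀ x y → RealNumbers._≈_ ℝ (d x y) (RealNumbers.0# ℝ) → x ≡ y) where
  open RealNumbers ℝ
  open IsCommutativeRing isCommutativeRing using (+-identityʳ)
  open IsTotalOrder isTotalOrder using (total; module Eq)
  open OrderedFieldProperties ℝ

  d-pos : ∀ {x y} → x ≢ y → 0# < d x y
  d-pos {x} {y} x≢y = nonneg x y , λ 0≈d → x≢y (definite x y (Eq.sym 0≈d))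

  x₂Labeling-square : (y : ℕ → V) → d (y 0) (y 3) ≤ d (y 0) (y 1) → y 1 ≢ y 2 →
                      X₂Labeling ℝ d 4 y
  x₂Labeling-square y d₀₃≤d₀₁ y₁≢y₂ = inj₂ (d₀₃<path , +-identityʳ (d (y 3) (y 0)))
    where
    d₀₃<path : d (y 0) (y 3) < d (y 0) (y 1) + d (y 1) (y 2) + d (y 2) (y 3)
    d₀₃<path = ≤-<-trans d₀₃≤d₀₁ (<-≤-trans (x<x+y (d-pos y₁≢y₂)) (x≤x+y (nonneg _ _)))

  square∈X₂ : (c : Fin 4 → V) → Injective _≡_ _≡_ c → X₂ ℝ d 4 c
  square∈X₂ c c-injective with total (d (c (# 0)) (c (# 3))) (d (c (# 0)) (c (# 1)))
  ... | inj₁ d₀₃≤d₀₁ =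
    true , 0 , x₂Labeling-square (relabel ℝ 3 c true 0) d₀₃≤d₀₁ (λ eq → case c-injective eq of λ ())
  -- relabel ℝ 3 c false 0 reads the cycle backwards: c₀, c₃, c₂, c₁.
  ... | inj₂ d₀₁≤d₀₃ =
    false , 0 , x₂Labeling-square (relabel ℝ 3 c false 0) d₀₁≤d₀₃ (λ eq → case c-injective eq of λ ())

proposition2p1 : (ℝ : RealNumbers) → {V : Set} → Countable ℝ V →
    (w : V → V → RealNumbers.Carrier ℝ) → (μ : V → RealNumbers.Carrier ℝ) →
    IsWeightedGraph ℝ w μ → LocallyFinite ℝ w →
    (d : V → V → RealNumbers.Carrier ℝ) → IsGeneralPathDistance ℝ w d →
    (n : ℕ) → (n ≡ 3 ⊎ n ≡ 4) → (c : Fin n → V) → IsCycle ℝ w n c →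
    X₂ ℝ d n c
proposition2p1 ℝ _ _ _ _ _ d _ .3 (inj₁ refl) c _ = true , 0 , inj₁ refl
proposition2p1 ℝ _ _ _ _ _ d (nonneg , _ , definite , _) .4 (inj₂ refl) c (_ , c-injective , _) =
  square∈X₂ c c-injective
  where open DefiniteDistance ℝ d nonneg (λ x y → proj₁ (definite x y))
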